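{- Let $G$ be a transitive permutation group on a finite set $\Omega$ with $|\Omega|>1$. Suppose the stabilizer $G_x$ of some $x\in\Omega$ contains an involution $\tau$ that acts semi-regularly on $\Omega\setminus\{x\}$, and that $G$ has a transitive normal subgroup $M$ of odd order. Then the following are equivalent: (i) $M$ is abelian; (ii) $M$ acts regularly (sharply transitively) on $\Omega$; (iii) the involution $\tau$ acts semi-regularly on $M$ by conjugation (i.e. fixes no non-trivial element of $M$). If one (hence every) of these conditions holds, then $\langle\tau\rangle M$ is a generalized dihedral group: conjugation by $\tau$ inverts every element of $M$, and $\langle\tau\rangle M=\tau^M\cup M$.
   Context: A permutation is semi-regular on a set if it (and its non-trivial powers, here just itself) fixes no element of that set. $\tau^M$ denotes the conjugacy class $\{m^{ -1}\tau m: m\in M\}$. -}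

module Defs where

open import Data.Nat using (ℕ; zero; suc)
open import Data.Nat.Divisibility using (_∣_)
open import Data.Fin using (Fin)
open import Data.Fin.Permutation using (Permutation′; _⟨$⟩ʳ_; _∘ₚ_; flip; id; _≈_)
open import Data.Product using (Σ; ∃; _×_; ∃-syntax)
open import Data.Sum using (_⊎_)
open import Relation.Binary.PropositionalEquality using (_≡_; _≢_)
open import Relation.Nullary using (¬_)

-- Permutations of Ω = Fin n; composition π ∘ₚ ρ means "first π, then ρ"
-- (right actions, as in the paper's notation m⁻¹ τ m).
Perm : ℕ → Set
Perm n = Permutation′ n

PermSet : ℕ → Set₁
PermSet n = Perm n → Set

record IsPermGroup {n : ℕ} (G : PermSet n) : Set where
  field
    respects : ∀ {π ρ} → π ≈ ρ → G π → G ρ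
    id∈      : G id
    ∘∈       : ∀ {π ρ} → G π → G ρ → G (π ∘ₚ ρ)
    inv∈     : ∀ {π} → G π → G (flip π)

_⊆_ : {n : ℕ} → PermSet n → PermSet n → Set
H ⊆ G = ∀ {π} → H π → G π

_^^_ : {n : ℕ} → Perm n → Perm n → Perm n
π ^^ m = flip m ∘ₚ π ∘ₚ m

IsNormalSubgroup : {n : ℕ} → PermSet n → PermSet n → Set
IsNormalSubgroup H G =
  IsPermGroup H × H ⊆ G × (∀ {g m} → G g → H m → H (m ^^ g))

IsTransitive : {n : ℕ} → PermSet n → Set
IsTransitive {n} G = ∀ (i j : Fin n) → ∃[ g ] (G g × g ⟨$⟩ʳ i ≡ j)

IsRegular : {n : ℕ} → PermSet n → Set
IsRegular {n} G =
  IsTransitive G × (∀ {g} (i : Fin n) → G g → g ⟨$⟩ʳ i ≡ i → g ≈ id)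

IsAbelian : {n : ℕ} → PermSet n → Set
IsAbelian G = ∀ {a b} → G a → G b → a ∘ₚ b ≈ b ∘ₚ a

HasOrder : {n : ℕ} → PermSet n → ℕ → Set
HasOrder {n} H k =
  Σ (Fin k → Perm n) λ f →
    (∀ i → H (f i)) ×
    (∀ {π} → H π → ∃[ i ] (f i ≈ π)) ×
    (∀ i j → f i ≈ f j → i ≡ j)

HasOddOrder : {n : ℕ} → PermSet n → Set
HasOddOrder H = ∃[ k ] (HasOrder H k × ¬ (2 ∣ k))

IsInvolution : {n : ℕ} → Perm n → Set
IsInvolution τ = ¬ (τ ≈ id) × (τ ∘ₚ τ ≈ id)

SemiregularOffPoint : {n : ℕ} → Perm n → Fin n → Set
SemiregularOffPoint {n} τ x = ∀ (y : Fin n) → y ≢ x → τ ⟨$⟩ʳ y ≢ y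

SemiregularByConj : {n : ℕ} → Perm n → PermSet n → Set
SemiregularByConj τ M = ∀ {m} → M m → m ^^ τ ≈ m → m ≈ id

_^ₚ_ : {n : ℕ} → Perm n → ℕ → Perm n
π ^ₚ zero = id
π ^ₚ suc k = π ∘ₚ (π ^ₚ k)

Cyclic : {n : ℕ} → Perm n → PermSet n
Cyclic τ σ = ∃[ k ] (σ ≈ τ ^ₚ k)

CyclicTimes : {n : ℕ} → Perm n → PermSet n → PermSet n
CyclicTimes τ M σ = ∃[ t ] ∃[ m ] (Cyclic τ t × M m × σ ≈ t ∘ₚ m)

ConjClass : {n : ℕ} → Perm n → PermSet n → PermSet n
ConjClass τ M σ = ∃[ m ] (M m × σ ≈ τ ^^ m)

-- If M is abelian and transitive it is regular. If M is regular, an element m of M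
-- centralised by τ commutes with τ, so τ fixes m x; semiregularity forces m x = x and
-- regularity m = 1. If τ centralises no non-trivial element of M, the commutator map
-- m ↦ m⁻¹ m^τ is injective on the finite group M, hence onto, and τ inverts every
-- commutator; a group all of whose elements are inverted by one element is abelian.
-- Finally, in a group of odd order there is no involution (right multiplication by it
-- would be a fixed-point-free involution of the group), so in the abelian group M
-- squaring is injective, hence onto, and τ a² = a⁻¹ τ a = τ^a for every a in M.

module Submission where

open import Algebra.Bundles using (Group)

-- Group elements are explicit arguments of the lemmas below because in the group of
-- permutations _≈_ unfolds to a pointwise statement, from which Agda cannot infer them.
module Conjugation {c ℓ} (𝔾 : Group c ℓ) where
  open Group 𝔾
  open import Algebra.Properties.Group 𝔾
  open import Relation.Binary.Reasoning.Setoid setoid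

  infixl 8 _^_
  _^_ : Carrier → Carrier → Carrier
  x ^ g = g ⁻¹ ∙ (x ∙ g)

  [_,_] : Carrier → Carrier → Carrier
  [ x , g ] = x ⁻¹ ∙ x ^ g

  ^-congˡ : ∀ {x y} g → x ≈ y → x ^ g ≈ y ^ g
  ^-congˡ g x≈y = ∙-congˡ (∙-congʳ x≈y)

  ^-congʳ : ∀ x {g h} → g ≈ h → x ^ g ≈ x ^ h
  ^-congʳ x g≈h = ∙-cong (⁻¹-cong g≈h) (∙-congˡ g≈h)

  ^≈⇒∙≈∙ : ∀ x y g → x ^ g ≈ y → x ∙ g ≈ g ∙ y
  ^≈⇒∙≈∙ x y g x^g≈y = begin
    x ∙ g          ≈⟨ \\-leftDividesˡ g (x ∙ g) ⟨
    g ∙ x ^ g      ≈⟨ ∙-congˡ x^g≈y ⟩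
    g ∙ y          ∎

  x^ε≈x : ∀ x → x ^ ε ≈ x
  x^ε≈x x = begin
    ε ⁻¹ ∙ (x ∙ ε) ≈⟨ ∙-cong ε⁻¹≈ε (identityʳ x) ⟩
    ε ∙ x          ≈⟨ identityˡ x ⟩
    x              ∎

  ε^g≈ε : ∀ g → ε ^ g ≈ ε
  ε^g≈ε g = begin
    g ⁻¹ ∙ (ε ∙ g) ≈⟨ ∙-congˡ (identityˡ g) ⟩
    g ⁻¹ ∙ g       ≈⟨ inverseˡ g ⟩
    ε              ∎

  ^-homo : ∀ g x y → (x ∙ y) ^ g ≈ x ^ g ∙ y ^ g
  ^-homo g x y = begin
    g ⁻¹ ∙ ((x ∙ y) ∙ g)                 ≈⟨ ∙-congˡ (assoc x y g) ⟩
    g ⁻¹ ∙ (x ∙ (y ∙ g))                 ≈⟨ ∙-congˡ (∙-congˡ (\\-leftDividesˡ g (y ∙ g))) ⟨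
    g ⁻¹ ∙ (x ∙ (g ∙ y ^ g))             ≈⟨ ∙-congˡ (assoc x g (y ^ g)) ⟨
    g ⁻¹ ∙ ((x ∙ g) ∙ y ^ g)             ≈⟨ assoc (g ⁻¹) (x ∙ g) (y ^ g) ⟨
    x ^ g ∙ y ^ g                        ∎

  ^-⁻¹ : ∀ g x → (x ⁻¹) ^ g ≈ (x ^ g) ⁻¹
  ^-⁻¹ g x = inverseʳ-unique (x ^ g) ((x ⁻¹) ^ g) (begin
    x ^ g ∙ (x ⁻¹) ^ g ≈⟨ ^-homo g x (x ⁻¹) ⟨
    (x ∙ x ⁻¹) ^ g     ≈⟨ ^-congˡ g (inverseʳ x) ⟩
    ε ^ g              ≈⟨ ε^g≈ε g ⟩
    ε                  ∎)

  ^-∙ : ∀ x g h → x ^ (g ∙ h) ≈ (x ^ g) ^ h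
  ^-∙ x g h = begin
    (g ∙ h) ⁻¹ ∙ (x ∙ (g ∙ h))        ≈⟨ ∙-cong (⁻¹-anti-homo-∙ g h) (sym (assoc x g h)) ⟩
    (h ⁻¹ ∙ g ⁻¹) ∙ ((x ∙ g) ∙ h)     ≈⟨ assoc (h ⁻¹) (g ⁻¹) ((x ∙ g) ∙ h) ⟩
    h ⁻¹ ∙ (g ⁻¹ ∙ ((x ∙ g) ∙ h))     ≈⟨ ∙-congˡ (assoc (g ⁻¹) (x ∙ g) h) ⟨
    (x ^ g) ^ h                        ∎

  ^-involutive : ∀ t → t ∙ t ≈ ε → ∀ x → (x ^ t) ^ t ≈ x
  ^-involutive t t∙t≈ε x = begin
    (x ^ t) ^ t ≈⟨ ^-∙ x t t ⟨
    x ^ (t ∙ t) ≈⟨ ^-congʳ x t∙t≈ε ⟩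
    x ^ ε       ≈⟨ x^ε≈x x ⟩
    x           ∎

  inverted⇒comm : ∀ t x y → x ^ t ≈ x ⁻¹ → y ^ t ≈ y ⁻¹ →
    (x ∙ y) ^ t ≈ (x ∙ y) ⁻¹ → x ∙ y ≈ y ∙ x
  inverted⇒comm t x y x^t y^t xy^t = begin
    x ∙ y                  ≈⟨ ⁻¹-involutive (x ∙ y) ⟨
    ((x ∙ y) ⁻¹) ⁻¹        ≈⟨ ⁻¹-cong xy^t ⟨
    ((x ∙ y) ^ t) ⁻¹       ≈⟨ ⁻¹-cong (^-homo t x y) ⟩
    (x ^ t ∙ y ^ t) ⁻¹     ≈⟨ ⁻¹-cong (∙-cong x^t y^t) ⟩
    (x ⁻¹ ∙ y ⁻¹) ⁻¹       ≈⟨ ⁻¹-anti-homo-∙ (x ⁻¹) (y ⁻¹) ⟩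
    y ⁻¹ ⁻¹ ∙ x ⁻¹ ⁻¹      ≈⟨ ∙-cong (⁻¹-involutive y) (⁻¹-involutive x) ⟩
    y ∙ x                  ∎

  commutator-cong⇒fixed : ∀ t a b → [ a , t ] ≈ [ b , t ] → (b ∙ a ⁻¹) ^ t ≈ b ∙ a ⁻¹
  commutator-cong⇒fixed t a b eq = begin
    (b ∙ a ⁻¹) ^ t        ≈⟨ ^-homo t b (a ⁻¹) ⟩
    b ^ t ∙ (a ⁻¹) ^ t    ≈⟨ ∙-congˡ (^-⁻¹ t a) ⟩
    b ^ t ∙ (a ^ t) ⁻¹    ≈⟨ x≈z//y (b ∙ a ⁻¹) (a ^ t) (b ^ t) b/a∙a^t≈b^t ⟨
    b ∙ a ⁻¹              ∎
    where
    b/a∙a^t≈b^t : (b ∙ a ⁻¹) ∙ a ^ t ≈ b ^ t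
    b/a∙a^t≈b^t = begin
      (b ∙ a ⁻¹) ∙ a ^ t  ≈⟨ assoc b (a ⁻¹) (a ^ t) ⟩
      b ∙ [ a , t ]       ≈⟨ ∙-congˡ eq ⟩
      b ∙ [ b , t ]       ≈⟨ \\-leftDividesˡ b (b ^ t) ⟩
      b ^ t               ∎

  commutator-inverted : ∀ t → t ∙ t ≈ ε → ∀ m g → g ≈ [ m , t ] → g ^ t ≈ g ⁻¹
  commutator-inverted t t∙t≈ε m g g≈[m,t] = begin
    g ^ t                       ≈⟨ ^-congˡ t g≈[m,t] ⟩
    (m ⁻¹ ∙ m ^ t) ^ t          ≈⟨ ^-homo t (m ⁻¹) (m ^ t) ⟩
    (m ⁻¹) ^ t ∙ (m ^ t) ^ t    ≈⟨ ∙-cong (^-⁻¹ t m) (^-involutive t t∙t≈ε m) ⟩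
    (m ^ t) ⁻¹ ∙ m              ≈⟨ ∙-congˡ (⁻¹-involutive m) ⟨
    (m ^ t) ⁻¹ ∙ m ⁻¹ ⁻¹        ≈⟨ ⁻¹-anti-homo-∙ (m ⁻¹) (m ^ t) ⟨
    [ m , t ] ⁻¹                ≈⟨ ⁻¹-cong g≈[m,t] ⟨
    g ⁻¹                        ∎

  inverted⇒∙square≈^ : ∀ t a → a ^ t ≈ a ⁻¹ → t ∙ (a ∙ a) ≈ t ^ a
  inverted⇒∙square≈^ t a a^t≈a⁻¹ = begin
    t ∙ (a ∙ a)       ≈⟨ assoc t a a ⟨
    (t ∙ a) ∙ a       ≈⟨ ∙-congʳ (^≈⇒∙≈∙ (a ⁻¹) a t a⁻¹^t≈a) ⟨
    (a ⁻¹ ∙ t) ∙ a    ≈⟨ assoc (a ⁻¹) t a ⟩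
    t ^ a             ∎
    where
    a⁻¹^t≈a : (a ⁻¹) ^ t ≈ a
    a⁻¹^t≈a = begin
      (a ⁻¹) ^ t   ≈⟨ ^-⁻¹ t a ⟩
      (a ^ t) ⁻¹   ≈⟨ ⁻¹-cong a^t≈a⁻¹ ⟩
      a ⁻¹ ⁻¹      ≈⟨ ⁻¹-involutive a ⟩
      a            ∎

  ^≈∙ : ∀ t a → t ^ a ≈ t ∙ ((a ⁻¹) ^ t ∙ a)
  ^≈∙ t a = begin
    a ⁻¹ ∙ (t ∙ a)          ≈⟨ assoc (a ⁻¹) t a ⟨
    (a ⁻¹ ∙ t) ∙ a          ≈⟨ ∙-congʳ (^≈⇒∙≈∙ (a ⁻¹) ((a ⁻¹) ^ t) t refl) ⟩
    (t ∙ (a ⁻¹) ^ t) ∙ a    ≈⟨ assoc t ((a ⁻¹) ^ t) a ⟩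
    t ∙ ((a ⁻¹) ^ t ∙ a)    ∎

  equal-squares⇒//-square≈ε : ∀ a b → a ∙ b ⁻¹ ≈ b ⁻¹ ∙ a → a ∙ a ≈ b ∙ b →
    (a // b) ∙ (a // b) ≈ ε
  equal-squares⇒//-square≈ε a b comm a²≈b² = begin
    (a ∙ b ⁻¹) ∙ (a ∙ b ⁻¹)     ≈⟨ assoc a (b ⁻¹) (a ∙ b ⁻¹) ⟩
    a ∙ (b ⁻¹ ∙ (a ∙ b ⁻¹))     ≈⟨ ∙-congˡ (assoc (b ⁻¹) a (b ⁻¹)) ⟨
    a ∙ ((b ⁻¹ ∙ a) ∙ b ⁻¹)     ≈⟨ ∙-congˡ (∙-congʳ comm) ⟨
    a ∙ ((a ∙ b ⁻¹) ∙ b ⁻¹)     ≈⟨ ∙-congˡ (assoc a (b ⁻¹) (b ⁻¹)) ⟩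
    a ∙ (a ∙ (b ⁻¹ ∙ b ⁻¹))     ≈⟨ assoc a a (b ⁻¹ ∙ b ⁻¹) ⟨
    (a ∙ a) ∙ (b ⁻¹ ∙ b ⁻¹)     ≈⟨ ∙-cong a²≈b² (sym (⁻¹-anti-homo-∙ b b)) ⟩
    (b ∙ b) ∙ (b ∙ b) ⁻¹        ≈⟨ inverseʳ (b ∙ b) ⟩
    ε                           ∎

open import Level using (0ℓ)
open import Data.Nat using (ℕ; zero; suc; 2+; _<_)
open import Data.Nat.Divisibility using (_∣_; divides)
open import Data.Nat.Properties using (n<1+n)
open import Data.Fin using (Fin; punchIn; punchOut)
open import Data.Fin.Patterns using (0F)
open import Data.Fin.Properties using (_≟_; any?; all?; punchIn-injective; punchInᵢ≢i; punchIn-punchOut; punchOut-injective; <⇒notInjective)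
open import Data.Product using (∃-syntax; _×_; _,_; proj₁; proj₂)
open import Data.Sum using (_⊎_; inj₁; inj₂)
open import Data.Empty using (⊥-elim)
open import Function using (_∘_)
open import Function.Bundles using (_⇔_; mk⇔)
open import Function.Definitions using (Injective)
open import Relation.Nullary using (¬_; yes; no)
open import Relation.Nullary.Decidable using (decidable-stable)
open import Relation.Binary.PropositionalEquality using (_≡_; _≢_; refl; sym; trans; cong; module ≡-Reasoning)

injective⇒surjective : ∀ {k} (h : Fin k → Fin k) → Injective _≡_ _≡_ h → ∀ y → ∃[ i ] h i ≡ y
injective⇒surjective {zero} _ _ ()
injective⇒surjective {suc k} h h-inj y with any? (λ i → h i ≟ y)
... | yes hit = hit
... | no miss = ⊥-elim (<⇒notInjective (n<1+n k) missing-injective)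
  where
  missing : Fin (suc k) → Fin k
  missing i = punchOut (λ y≡hi → miss (i , sym y≡hi))
  missing-injective : Injective _≡_ _≡_ missing
  missing-injective = h-inj ∘ punchOut-injective {i = y} _ _

IsFreeInvolution : ∀ {k} → (Fin k → Fin k) → Set
IsFreeInvolution h = (∀ i → h (h i) ≡ i) × (∀ i → h i ≢ i)

free-involution-restrict : ∀ {m k} (e : Fin m → Fin k) → Injective _≡_ _≡_ e →
  (h : Fin k → Fin k) → IsFreeInvolution h → (∀ i → ∃[ j ] e j ≡ h (e i)) →
  ∃[ h′ ] IsFreeInvolution h′
free-involution-restrict {m} e e-inj h (involutive , free) invariant = h′ , h′-involutive , h′-free
  where
  h′ : Fin m → Fin m
  h′ i = proj₁ (invariant i)
  e∘h′ : ∀ i → e (h′ i) ≡ h (e i)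
  e∘h′ i = proj₂ (invariant i)
  h′-involutive : ∀ i → h′ (h′ i) ≡ i
  h′-involutive i = e-inj (begin
    e (h′ (h′ i)) ≡⟨ e∘h′ (h′ i) ⟩
    h (e (h′ i))  ≡⟨ cong h (e∘h′ i) ⟩
    h (h (e i))   ≡⟨ involutive (e i) ⟩
    e i           ∎)
    where open ≡-Reasoning
  h′-free : ∀ i → h′ i ≢ i
  h′-free i h′i≡i = free (e i) (trans (sym (e∘h′ i)) (cong e h′i≡i))

punchIn²-onto : ∀ {n} (a : Fin (2+ n)) (b : Fin (suc n)) (y : Fin (2+ n)) →
  a ≢ y → punchIn a b ≢ y → ∃[ j ] punchIn a (punchIn b j) ≡ y
punchIn²-onto a b y a≢y a∘b≢y = punchOut b≢y′ , (begin
  punchIn a (punchIn b (punchOut b≢y′)) ≡⟨ cong (punchIn a) (punchIn-punchOut b≢y′) ⟩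
  punchIn a (punchOut a≢y)             ≡⟨ punchIn-punchOut a≢y ⟩
  y                                     ∎)
  where
  open ≡-Reasoning
  b≢y′ : b ≢ punchOut a≢y
  b≢y′ b≡y′ = a∘b≢y (trans (cong (punchIn a) b≡y′) (punchIn-punchOut a≢y))

free-involution-drop-pair : ∀ {m} (h : Fin (2+ m) → Fin (2+ m)) → IsFreeInvolution h →
  ∃[ h′ ] IsFreeInvolution {m} h′
free-involution-drop-pair {m} h free-inv@(involutive , free) =
  free-involution-restrict e e-injective h free-inv invariant
  where
  0≢h0 : 0F ≢ h 0F
  0≢h0 = free 0F ∘ sym
  a : Fin (suc m)
  a = punchOut 0≢h0
  e : Fin m → Fin (2+ m)
  e i = punchIn 0F (punchIn a i)
  e-injective : Injective _≡_ _≡_ e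
  e-injective = punchIn-injective a _ _ ∘ punchIn-injective 0F _ _
  invariant : ∀ i → ∃[ j ] e j ≡ h (e i)
  invariant i = punchIn²-onto 0F a (h (e i)) 0≢he a≢he
    where
    open ≡-Reasoning
    h0≡a : h 0F ≡ punchIn 0F a
    h0≡a = sym (punchIn-punchOut 0≢h0)
    0≢he : 0F ≢ h (e i)
    0≢he 0≡he = punchInᵢ≢i a i (sym (punchIn-injective 0F _ _ (begin
      punchIn 0F a ≡⟨ sym h0≡a ⟩
      h 0F         ≡⟨ cong h 0≡he ⟩
      h (h (e i))  ≡⟨ involutive (e i) ⟩
      e i          ∎)))
    a≢he : punchIn 0F a ≢ h (e i)
    a≢he a≡he = punchInᵢ≢i 0F (punchIn a i) (begin
      e i              ≡⟨ sym (involutive (e i)) ⟩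
      h (h (e i))      ≡⟨ cong h (sym a≡he) ⟩
      h (punchIn 0F a) ≡⟨ cong h (sym h0≡a) ⟩
      h (h 0F)         ≡⟨ involutive 0F ⟩
      0F               ∎)

free-involution⇒even : ∀ k (h : Fin k → Fin k) → IsFreeInvolution h → 2 ∣ k
free-involution⇒even zero _ _ = divides 0 refl
free-involution⇒even (suc zero) h (_ , free) with h 0F in h0≡0
... | 0F = ⊥-elim (free 0F h0≡0)
free-involution⇒even (suc (suc m)) h free-inv
  with h′ , free-inv′ ← free-involution-drop-pair h free-inv
  with divides q m≡q*2 ← free-involution⇒even m h′ free-inv′
  = divides (suc q) (cong 2+ m≡q*2)

open import Defs
open import Data.Fin.Permutation using (_⟨$⟩ʳ_; _⟨$⟩ˡ_; _∘ₚ_; flip; id; _≈_; inverseˡ; inverseʳ)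

flip-cong : ∀ {n} (π ρ : Perm n) → π ≈ ρ → flip π ≈ flip ρ
flip-cong π ρ π≈ρ i = begin
  π ⟨$⟩ˡ i                        ≡⟨ cong (π ⟨$⟩ˡ_) (inverseʳ ρ) ⟨
  π ⟨$⟩ˡ (ρ ⟨$⟩ʳ (ρ ⟨$⟩ˡ i))      ≡⟨ cong (π ⟨$⟩ˡ_) (π≈ρ _) ⟨
  π ⟨$⟩ˡ (π ⟨$⟩ʳ (ρ ⟨$⟩ˡ i))      ≡⟨ inverseˡ π ⟩
  ρ ⟨$⟩ˡ i                        ∎
  where open ≡-Reasoning

Sym : ℕ → Group 0ℓ 0ℓ
Sym n = record
  { Carrier = Perm n
  ; _≈_ = _≈_
  ; _∙_ = _∘ₚ_
  ; ε = id
  ; _⁻¹ = flip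
  ; isGroup = record
    { isMonoid = record
      { isSemigroup = record
        { isMagma = record
          { isEquivalence = record
            { refl = λ _ → refl
            ; sym = λ π≈ρ i → sym (π≈ρ i)
            ; trans = λ π≈ρ ρ≈σ i → trans (π≈ρ i) (ρ≈σ i)
            }
          ; ∙-cong = λ {_} {_} {ρ} π≈π′ ρ≈ρ′ i → trans (cong (ρ ⟨$⟩ʳ_) (π≈π′ i)) (ρ≈ρ′ _)
          }
        ; assoc = λ _ _ _ _ → refl
        }
      ; identity = (λ _ _ → refl) , (λ _ _ → refl)
      }
    ; inverse = (λ π _ → inverseʳ π) , (λ π _ → inverseˡ π)
    ; ⁻¹-cong = λ {π} {ρ} → flip-cong π ρ
    }
  }

module _ {n : ℕ} where
  open import Algebra.Properties.Group (Sym n) using (identityʳ-unique; x∙y⁻¹≈ε⇒x≈y)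
  open Conjugation (Sym n)

  abelian∧transitive⇒regular : {H : PermSet n} → IsAbelian H → IsTransitive H → IsRegular H
  abelian∧transitive⇒regular {H} abelian transitive = transitive , fixes⇒≈id
    where
    fixes⇒≈id : ∀ {g} i → H g → g ⟨$⟩ʳ i ≡ i → g ≈ id
    fixes⇒≈id {g} i g∈H gi≡i j with h , h∈H , hi≡j ← transitive i j = begin
      g ⟨$⟩ʳ j              ≡⟨ cong (g ⟨$⟩ʳ_) hi≡j ⟨
      g ⟨$⟩ʳ (h ⟨$⟩ʳ i)     ≡⟨ abelian h∈H g∈H i ⟩
      h ⟨$⟩ʳ (g ⟨$⟩ʳ i)     ≡⟨ cong (h ⟨$⟩ʳ_) gi≡i ⟩
      h ⟨$⟩ʳ i              ≡⟨ hi≡j ⟩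
      j                     ∎
      where open ≡-Reasoning

  regular⇒semiregularByConj : {H : PermSet n} (x : Fin n) (τ : Perm n) →
    τ ⟨$⟩ʳ x ≡ x → SemiregularOffPoint τ x → IsRegular H → SemiregularByConj τ H
  regular⇒semiregularByConj x τ τx≡x semiregular (_ , regular) {m} m∈H m^τ≈m =
    regular x m∈H (decidable-stable (m ⟨$⟩ʳ x ≟ x) (λ mx≢x → semiregular _ mx≢x τ-fixes-mx))
    where
    τ-fixes-mx : τ ⟨$⟩ʳ (m ⟨$⟩ʳ x) ≡ m ⟨$⟩ʳ x
    τ-fixes-mx = trans (^≈⇒∙≈∙ m m τ m^τ≈m x) (cong (m ⟨$⟩ʳ_) τx≡x)

  involution-powers : ∀ {τ : Perm n} → τ ∘ₚ τ ≈ id → ∀ k → τ ^ₚ k ≈ id ⊎ τ ^ₚ k ≈ τ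
  involution-powers ττ≈id zero = inj₁ λ _ → refl
  involution-powers {τ} ττ≈id (suc k) with involution-powers ττ≈id k
  ... | inj₁ τᵏ≈id = inj₂ λ i → τᵏ≈id (τ ⟨$⟩ʳ i)
  ... | inj₂ τᵏ≈τ  = inj₁ λ i → trans (τᵏ≈τ (τ ⟨$⟩ʳ i)) (ττ≈id i)

  inverted⇒abelian : {H : PermSet n} (τ : Perm n) → IsPermGroup H →
    (∀ {m} → H m → m ^^ τ ≈ flip m) → IsAbelian H
  inverted⇒abelian τ H-group inverted {a} {b} a∈H b∈H =
    inverted⇒comm τ a b (inverted a∈H) (inverted b∈H) (inverted (∘∈ a∈H b∈H))
    where open IsPermGroup H-group

  commutator-injective : {H : PermSet n} (τ : Perm n) → IsPermGroup H → SemiregularByConj τ H →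
    ∀ {a b} → H a → H b → [ a , τ ] ≈ [ b , τ ] → a ≈ b
  commutator-injective τ H-group semiregular {a} {b} a∈H b∈H eq z =
    sym (x∙y⁻¹≈ε⇒x≈y b a (semiregular (∘∈ b∈H (inv∈ a∈H)) (commutator-cong⇒fixed τ a b eq)) z)
    where open IsPermGroup H-group

  module FiniteGroup {k : ℕ} {H : PermSet n} (H-group : IsPermGroup H) (order : HasOrder H k) where
    open IsPermGroup H-group

    private
      enum : Fin k → Perm n
      enum = proj₁ order
      enum∈H : ∀ i → H (enum i)
      enum∈H = proj₁ (proj₂ order)
      enum-onto : ∀ {π} → H π → ∃[ i ] (enum i ≈ π)
      enum-onto = proj₁ (proj₂ (proj₂ order))
      enum-injective : ∀ i j → enum i ≈ enum j → i ≡ j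
      enum-injective = proj₂ (proj₂ (proj₂ order))

    module _ (φ : Perm n → Perm n) (φ∈H : ∀ {a} → H a → H (φ a)) where

      induced : Fin k → Fin k
      induced i = proj₁ (enum-onto (φ∈H (enum∈H i)))

      enum-induced : ∀ i → enum (induced i) ≈ φ (enum i)
      enum-induced i = proj₂ (enum-onto (φ∈H (enum∈H i)))

      module _ (φ-injective : ∀ {a b} → H a → H b → φ a ≈ φ b → a ≈ b) where

        induced-injective : Injective _≡_ _≡_ induced
        induced-injective {i} {i′} eq =
          enum-injective i i′ (φ-injective (enum∈H i) (enum∈H i′) λ z →
            trans (sym (enum-induced i z)) (trans (cong (λ l → enum l ⟨$⟩ʳ z) eq) (enum-induced i′ z)))

        injective⇒onto : ∀ {m} → H m → ∃[ a ] (H a × φ a ≈ m)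
        injective⇒onto m∈H
          with j , enum-j≈m ← enum-onto m∈H
          with i , induced-i≡j ← injective⇒surjective induced induced-injective j
          = enum i , enum∈H i , λ z →
              trans (sym (enum-induced i z)) (trans (cong (λ l → enum l ⟨$⟩ʳ z) induced-i≡j) (enum-j≈m z))

    odd-order⇒no-involution : ¬ 2 ∣ k → ∀ {c} → H c → c ∘ₚ c ≈ id → c ≈ id
    odd-order⇒no-involution odd {c} c∈H cc≈id =
      decidable-stable (all? λ i → c ⟨$⟩ʳ i ≟ i) λ c≉id →
        odd (free-involution⇒even k ρ (ρ-involutive , ρ-free c≉id))
      where
      ∘c∈H : ∀ {a} → H a → H (a ∘ₚ c)
      ∘c∈H a∈H = ∘∈ a∈H c∈H
      ρ : Fin k → Fin k
      ρ = induced (_∘ₚ c) ∘c∈H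
      ρ-involutive : ∀ i → ρ (ρ i) ≡ i
      ρ-involutive i = enum-injective (ρ (ρ i)) i λ z → begin
        enum (ρ (ρ i)) ⟨$⟩ʳ z             ≡⟨ enum-induced (_∘ₚ c) ∘c∈H (ρ i) z ⟩
        c ⟨$⟩ʳ (enum (ρ i) ⟨$⟩ʳ z)        ≡⟨ cong (c ⟨$⟩ʳ_) (enum-induced (_∘ₚ c) ∘c∈H i z) ⟩
        c ⟨$⟩ʳ (c ⟨$⟩ʳ (enum i ⟨$⟩ʳ z))   ≡⟨ cc≈id (enum i ⟨$⟩ʳ z) ⟩
        enum i ⟨$⟩ʳ z                     ∎
        where open ≡-Reasoning
      ρ-free : ¬ c ≈ id → ∀ i → ρ i ≢ i
      ρ-free c≉id i ρi≡i = c≉id (identityʳ-unique (enum i) c λ z →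
        trans (sym (enum-induced (_∘ₚ c) ∘c∈H i z)) (cong (λ l → enum l ⟨$⟩ʳ z) ρi≡i))

    semiregular⇒inverted : ∀ τ → τ ∘ₚ τ ≈ id → (∀ {m} → H m → H (m ^^ τ)) →
      SemiregularByConj τ H → ∀ {g} → H g → g ^^ τ ≈ flip g
    semiregular⇒inverted τ ττ≈id conj∈H semiregular {g} g∈H
      with m , _ , [m,τ]≈g ← injective⇒onto [_, τ ] (λ m∈H → ∘∈ (inv∈ m∈H) (conj∈H m∈H))
                               (commutator-injective τ H-group semiregular) g∈H
      = commutator-inverted τ ττ≈id m g λ z → sym ([m,τ]≈g z)

    odd-order⇒square-root : ¬ 2 ∣ k → IsAbelian H → ∀ {m} → H m → ∃[ a ] (H a × a ∘ₚ a ≈ m)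
    odd-order⇒square-root odd abelian = injective⇒onto (λ a → a ∘ₚ a) (λ a∈H → ∘∈ a∈H a∈H) square-injective
      where
      square-injective : ∀ {a b} → H a → H b → a ∘ₚ a ≈ b ∘ₚ b → a ≈ b
      square-injective {a} {b} a∈H b∈H a²≈b² = x∙y⁻¹≈ε⇒x≈y a b
        (odd-order⇒no-involution odd (∘∈ a∈H (inv∈ b∈H))
          (equal-squares⇒//-square≈ε a b (abelian a∈H (inv∈ b∈H)) a²≈b²))

  generalized-dihedral : {H : PermSet n} (τ : Perm n) → IsPermGroup H → τ ∘ₚ τ ≈ id →
    (∀ {m} → H m → H (m ^^ τ)) → (∀ {m} → H m → m ^^ τ ≈ flip m) →
    (∀ {m} → H m → ∃[ a ] (H a × a ∘ₚ a ≈ m)) →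
    ∀ σ → CyclicTimes τ H σ ⇔ (ConjClass τ H σ ⊎ H σ)
  generalized-dihedral {H} τ H-group ττ≈id conj∈H inverted square-root σ = mk⇔ to from
    where
    open IsPermGroup H-group
    open ≡-Reasoning
    to : CyclicTimes τ H σ → ConjClass τ H σ ⊎ H σ
    to (t , m , (j , t≈τʲ) , m∈H , σ≈tm) with involution-powers ττ≈id j | square-root m∈H
    ... | inj₁ τʲ≈id | _ =
      inj₂ (respects (λ z → sym (trans (σ≈tm z) (cong (m ⟨$⟩ʳ_) (trans (t≈τʲ z) (τʲ≈id z))))) m∈H)
    ... | inj₂ τʲ≈τ | a , a∈H , a²≈m = inj₁ (a , a∈H , λ z → begin
      σ ⟨$⟩ʳ z                ≡⟨ σ≈tm z ⟩
      m ⟨$⟩ʳ (t ⟨$⟩ʳ z)       ≡⟨ cong (m ⟨$⟩ʳ_) (trans (t≈τʲ z) (τʲ≈τ z)) ⟩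
      m ⟨$⟩ʳ (τ ⟨$⟩ʳ z)       ≡⟨ a²≈m (τ ⟨$⟩ʳ z) ⟨
      (τ ∘ₚ a ∘ₚ a) ⟨$⟩ʳ z    ≡⟨ inverted⇒∙square≈^ τ a (inverted a∈H) z ⟩
      (τ ^^ a) ⟨$⟩ʳ z         ∎)
    from : ConjClass τ H σ ⊎ H σ → CyclicTimes τ H σ
    from (inj₁ (a , a∈H , σ≈τ^a)) =
      τ , (flip a ^^ τ) ∘ₚ a , (1 , λ _ → refl) , ∘∈ (conj∈H (inv∈ a∈H)) a∈H ,
      λ z → trans (σ≈τ^a z) (^≈∙ τ a z)
    from (inj₂ σ∈H) = id , σ , (0 , λ _ → refl) , σ∈H , λ _ → refl

lemma3p1 : (n : ℕ) → 1 < n → (G M : PermSet n) → IsPermGroup G → IsTransitive G →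
    (x : Fin n) → (τ : Perm n) → G τ → τ ⟨$⟩ʳ x ≡ x → IsInvolution τ →
    SemiregularOffPoint τ x →
    IsNormalSubgroup M G → IsTransitive M → HasOddOrder M →
    ((IsAbelian M ⇔ IsRegular M) × (IsRegular M ⇔ SemiregularByConj τ M))
    × (IsAbelian M →
        (∀ {m} → M m → m ^^ τ ≈ flip m)
        × (∀ σ → CyclicTimes τ M σ ⇔ (ConjClass τ M σ ⊎ M σ)))
lemma3p1 _ _ _ M _ _ x τ Gτ τx≡x (_ , ττ≈id) semiregular (M-group , _ , M-normal) M-transitive
  (k , order , odd) =
  ( mk⇔ abelian⇒regular (semiregular⇒abelian ∘ regular⇒semiregular)
  , mk⇔ regular⇒semiregular semiregular⇒regular )
  , λ abelian → abelian⇒inverted abelian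
              , generalized-dihedral τ M-group ττ≈id conj∈M (abelian⇒inverted abelian)
                  (odd-order⇒square-root odd abelian)
  where
  open FiniteGroup M-group order
  conj∈M : ∀ {m} → M m → M (m ^^ τ)
  conj∈M = M-normal Gτ
  abelian⇒regular : IsAbelian M → IsRegular M
  abelian⇒regular abelian = abelian∧transitive⇒regular abelian M-transitive
  regular⇒semiregular : IsRegular M → SemiregularByConj τ M
  regular⇒semiregular = regular⇒semiregularByConj x τ τx≡x semiregular
  semiregular⇒abelian : SemiregularByConj τ M → IsAbelian M
  semiregular⇒abelian sr = inverted⇒abelian τ M-group (semiregular⇒inverted τ ττ≈id conj∈M sr)
  semiregular⇒regular : SemiregularByConj τ M → IsRegular M
  semiregular⇒regular = abelian⇒regular ∘ semiregular⇒abelian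
  abelian⇒inverted : IsAbelian M → ∀ {m} → M m → m ^^ τ ≈ flip m
  abelian⇒inverted abelian = semiregular⇒inverted τ ττ≈id conj∈M (regular⇒semiregular (abelian⇒regular abelian))
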